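{- Let $1 \le \ell < n/2$ and consider a room of $n$ people, labelled $1,\dots,n$, each of whom is a knight or a spy, with at most $\ell$ spies present. Suppose a questioner follows the Spider Interrogation Strategy (described in the context), whatever the answers of the spies. Then the total number of questions asked is \[ n + \ell - 1 - r, \] where $r$ is the number of knights rejected as candidates in Step 1 of the strategy.
   Context: Setting: each of the $n$ people is either a knight or a spy; everyone knows everyone's identity; knights always answer truthfully, spies may answer truthfully or falsely as they please. The only permitted questions are "Person $i$, what is the identity of person $j$?", answered "knight" (called a support of $j$ by $i$) or "spy" (an accusation of $j$ by $i$). A person is "involved" once he has been a candidate or has been asked a question. Spider Interrogation Strategy. Step 1: Keep a threshold $L$, initially $L=\ell$. Choose as candidate a person not yet involved, and repeatedly ask new (not yet involved) people about the candidate until either (a) strictly more people have accused the candidate than have supported him, or (b) $L$ people have supported him. In case (a), if the candidate was accused by $a$ people (hence supported by $a-1$), he is rejected, all $2a$ people involved with him are set aside, $L$ is replaced by $L-a$, and Step 1 is repeated with a new candidate. In case (b) the candidate, call him person $k$, is accepted (he is then necessarily a knight), and all further questions are addressed to him. Step 2: ask person $k$ about each person not involved in Step 1 and about each rejected candidate. Step 3: for each rejected candidate $m$, accused by $a$ people: if $m$ is a knight, ask $k$ about each of the $a-1$ people who supported $m$; if $m$ is a spy, ask $k$ about each of the $a$ people who accused $m$. Step 4: ask $k$ about each person who supported $k$'s candidacy. (People who accused $k$ are spies.) At this point all identities are known. -}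

module Defs where

open import Data.Nat using (ℕ; zero; suc; _+_; _∸_; _<ᵇ_; _≡ᵇ_)
open import Data.Bool using (Bool; true; false; not; if_then_else_)
open import Data.Fin using (Fin)
open import Data.List using (List; []; _∷_; _++_; length; map; concatMap; filterᵇ; allFin)
open import Data.Product using (_×_; _,_)
open import Data.Maybe using (Maybe; just; nothing)

-- Identities: `true` = knight, `false` = spy.
-- Answers: `ans i j = true` means "person i says person j is a knight" (a support),
-- `false` means "spy" (an accusation).

-- A question "person i, what is the identity of person j?" is recorded as the pair (i , j).
Question : ℕ → Set
Question n = Fin n × Fin n

record Rejected (n : ℕ) : Set where
  constructor rej
  field
    cand       : Fin n
    accusers   : List (Fin n)
    supporters : List (Fin n)
open Rejected public

record Step1Result (n : ℕ) : Set where
  constructor step1res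
  field
    accepted    : Fin n
    kSupporters : List (Fin n)
    kAccusers   : List (Fin n)
    rejecteds   : List (Rejected n)
    notInvolved : List (Fin n)
    questions1  : List (Question n)
open Step1Result public

module _ {n : ℕ} (ans : Fin n → Fin n → Bool) where

  mutual
    -- Step 1, choosing a new candidate: `queue` lists the people not yet involved,
    -- in the order in which the questioner picks them.
    -- Returns `nothing` if the strategy cannot proceed (no uninvolved person left).
    step1 : (L : ℕ) → (queue : List (Fin n)) → List (Rejected n) → List (Question n)
          → Maybe (Step1Result n)
    step1 L []            rs qs = nothing
    step1 L (c ∷ queue)   rs qs = interrogate L c [] [] queue rs qs

    interrogate : (L : ℕ) → (c : Fin n) → (S A : List (Fin n)) → (queue : List (Fin n))
                → List (Rejected n) → List (Question n) → Maybe (Step1Result n)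
    interrogate L c S A queue rs qs =
      if length S <ᵇ length A
        then step1 (L ∸ length A) queue (rs ++ (rej c A S ∷ [])) qs
        else (if length S ≡ᵇ L
          then just (step1res c S A rs queue qs)
          else askNext L c S A queue rs qs)

    askNext : (L : ℕ) → (c : Fin n) → (S A : List (Fin n)) → (queue : List (Fin n))
            → List (Rejected n) → List (Question n) → Maybe (Step1Result n)
    askNext L c S A []          rs qs = nothing
    askNext L c S A (p ∷ queue) rs qs =
      if ans p c
        then interrogate L c (S ++ (p ∷ [])) A queue rs (qs ++ ((p , c) ∷ []))
        else interrogate L c S (A ++ (p ∷ [])) queue rs (qs ++ ((p , c) ∷ []))

  laterQuestions : Step1Result n → List (Question n)
  laterQuestions (step1res k kS kA rs rest qs) =
    map (λ p → (k , p)) rest ++ map (λ m → (k , cand m)) rs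
    -- Step 3 (the identity of m is as reported by k in Step 2)
    ++ concatMap (λ m → if ans k (cand m)
                          then map (λ p → (k , p)) (supporters m)
                          else map (λ p → (k , p)) (accusers m)) rs
    ++ map (λ p → (k , p)) kS

  spider : (ℓ : ℕ) → (order : List (Fin n)) → Maybe (Step1Result n × List (Question n))
  spider ℓ order with step1 ℓ order [] []
  ... | nothing = nothing
  ... | just res = just (res , questions1 res ++ laterQuestions res)

numSpies : {n : ℕ} → (Fin n → Bool) → ℕ
numSpies {n} knight = length (filterᵇ (λ i → not (knight i)) (allFin n))

rejectedKnights : {n : ℕ} → (Fin n → Bool) → Step1Result n → ℕ
rejectedKnights knight res = length (filterᵇ (λ m → knight (cand m)) (rejecteds res))

module Submission where

-- Step 1 is analysed through two conserved quantities.  Writing Σa for the total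
-- number of accusations received by rejected candidates, Σa + L stays equal to ℓ
-- (each rejection with a accusers lowers L by a), and every person is accounted for
-- exactly once: as a Step 1 respondent, a rejected candidate, the accepted candidate,
-- or an uninvolved person.  Step 1 also never gets stuck and accepts a knight; this
-- rests on the invariant that the people still in play contain at most L spies and at
-- least 2L others besides the candidate.  A rejection with a accusers removes at least
-- a spies (Lemma 'rejection-exposes-spies'), and an accepted candidate with L
-- supporters cannot be a spy, for then all L supporters would be spies as well.
-- Finally Step 3 asks a - 1 questions about a rejected knight and a about a rejected
-- spy, so Steps 2-4 contribute (uninvolved) + (rejected) + (Σa - r) + L_final, and
-- adding the Step 1 count gives n + ℓ - 1 - r.

open import Defs
open import Data.Nat using (ℕ; suc; _+_; _∸_; _*_; _≤_; _<_; z≤n; s≤s; _<ᵇ_; _≡ᵇ_)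
open import Data.Nat.Properties
open import Data.Bool using (Bool; true; false; not; if_then_else_; T)
open import Data.Bool.Properties using (not-¬)
open import Data.Unit using (tt)
open import Data.Fin using (Fin)
open import Data.List using (List; []; _∷_; _++_; [_]; length; map; concatMap; filterᵇ; allFin)
open import Data.List.Properties using (length-++; length-map; length-tabulate; filter-++; ++-assoc)
open import Data.List.Relation.Unary.All using (All; []; _∷_)
open import Data.List.Relation.Unary.All.Properties using (++⁺)
open import Data.List.Relation.Binary.Permutation.Propositional
  using (_↭_; prep; ↭-sym; ↭-trans; ↭-reflexive)
open import Data.List.Relation.Binary.Permutation.Propositional.Properties
  using (↭-length; filter-↭; shift; ++⁺ˡ)
open import Data.Product using (Σ; _×_; _,_; proj₁; proj₂)
open import Data.Maybe using (Maybe; just)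
open import Data.Empty using (⊥-elim)
open import Function using (_∘_)
open import Relation.Nullary using (¬_; contradiction)
open import Relation.Nullary.Decidable using (T?)
open import Relation.Binary.PropositionalEquality
  using (_≡_; refl; sym; trans; cong; cong₂; subst; subst₂; module ≡-Reasoning)
open import Data.Nat.Tactic.RingSolver using (solve-∀)

length-snoc : ∀ {A : Set} (xs : List A) (x : A) → length (xs ++ [ x ]) ≡ suc (length xs)
length-snoc xs x = trans (length-++ xs) (+-comm (length xs) 1)

length-filter-∷ : ∀ {A : Set} (p : A → Bool) x xs
                → length (filterᵇ p (x ∷ xs)) ≡ (if p x then 1 else 0) + length (filterᵇ p xs)
length-filter-∷ p x xs with p x
... | true  = refl
... | false = refl

rejection-keeps-majority : ∀ {s a L q} → a ≡ suc s → a ≤ L → 2 * L ≤ s + (a + q)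
                         → 2 * (L ∸ a) < q
rejection-keeps-majority {s} {_} {L} {q} refl a≤L majority =
  +-cancelˡ-≤ (s + suc s) _ _ (subst₂ _≤_ (lhs s (L ∸ suc s)) (rhs s q) majority′)
  where
  lhs : ∀ s L′ → 2 * (1 + s + L′) ≡ s + (1 + s) + (1 + 2 * L′)
  lhs = solve-∀
  rhs : ∀ s q → s + (1 + s + q) ≡ s + (1 + s) + q
  rhs = solve-∀
  majority′ : 2 * (suc s + (L ∸ suc s)) ≤ s + (suc s + q)
  majority′ = subst (λ x → 2 * x ≤ s + (suc s + q)) (sym (m+[n∸m]≡n a≤L)) majority

questions-below-majority : ∀ {L s a} → a ≤ s → s < L → ¬ (2 * L ≤ s + a)
questions-below-majority {L} {s} {a} a≤s s<L majority = <-irrefl refl (begin-strict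
  2 * L        ≤⟨ majority ⟩
  s + a        ≤⟨ +-monoʳ-≤ s a≤s ⟩
  s + s        <⟨ +-mono-< s<L s<L ⟩
  L + L        ≡⟨ cong (L +_) (sym (+-identityʳ L)) ⟩
  2 * L        ∎)
  where open ≤-Reasoning

-- The final bookkeeping: Step 1 asked q1 questions, Steps 2-4 asked
-- rest + rs + V + kS, where V + r = Σa, Σa + kS = ℓ and q1 + rs + 1 + rest = n.
total-count : ∀ {n ℓ q1 rest rs V kS r Σa} → Σa + kS ≡ ℓ → q1 + rs + suc rest ≡ n
            → V + r ≡ Σa → q1 + (rest + (rs + (V + kS))) + r ≡ n + ℓ ∸ 1
total-count {q1 = q1} {rest} {rs} {V} {kS} {r} refl refl refl =
  trans (regroup q1 rest rs V kS r) (cong (λ m → m + (V + r + kS) ∸ 1) (sym (+-suc (q1 + rs) rest)))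
  where
  regroup : ∀ q1 rest rs V kS r → q1 + (rest + (rs + (V + kS))) + r ≡ q1 + rs + rest + (V + r + kS)
  regroup = solve-∀

-- A person leaving the people in play (last summand) to become a rejected candidate
-- (middle summand) or a Step 1 respondent (first summand) keeps the head count.
moved-into-middle : ∀ {A : Set} x (ys : List A) y z → x + length (ys ++ [ y ]) + z ≡ x + length ys + suc z
moved-into-middle x ys y z =
  trans (cong (λ k → x + k + z) (length-snoc ys y)) (regroup x (length ys) z)
  where
  regroup : ∀ x y z → x + (1 + y) + z ≡ x + y + (1 + z)
  regroup = solve-∀

moved-into-first : ∀ {A : Set} (xs : List A) x y z → length (xs ++ [ x ]) + y + suc z ≡ length xs + y + suc (suc z)
moved-into-first xs x y z =
  trans (cong (λ k → k + y + suc z) (length-snoc xs x)) (regroup (length xs) y z)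
  where
  regroup : ∀ x y z → 1 + x + y + (1 + z) ≡ x + y + (1 + (1 + z))
  regroup = solve-∀

spider-after-step1 : ∀ {n} (ans : Fin n → Fin n → Bool) ℓ order res
                   → step1 ans ℓ order [] [] ≡ just res
                   → spider ans ℓ order ≡ just (res , questions1 res ++ laterQuestions ans res)
spider-after-step1 ans ℓ order res step1≡ rewrite step1≡ = refl

module Interrogation {n : ℕ} (knight : Fin n → Bool) (ans : Fin n → Fin n → Bool)
  (honest : ∀ i j → knight i ≡ true → ans i j ≡ knight j) where

  isSpy : Fin n → Bool
  isSpy = not ∘ knight

  spies : List (Fin n) → ℕ
  spies xs = length (filterᵇ isSpy xs)

  spies-++ : ∀ xs ys → spies (xs ++ ys) ≡ spies xs + spies ys
  spies-++ xs ys = trans (cong length (filter-++ (T? ∘ isSpy) xs ys)) (length-++ (filterᵇ isSpy xs))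

  spies-prefix : ∀ xs ys → spies xs ≤ spies (xs ++ ys)
  spies-prefix xs ys = subst (spies xs ≤_) (sym (spies-++ xs ys)) (m≤m+n (spies xs) (spies ys))

  spies-↭ : ∀ {xs ys} → xs ↭ ys → spies xs ≡ spies ys
  spies-↭ xs↭ys = ↭-length (filter-↭ (T? ∘ isSpy) xs↭ys)

  Supports Accuses : List (Fin n) → Fin n → Set
  Supports S c = All (λ s → ans s c ≡ true) S
  Accuses A c = All (λ a → ans a c ≡ false) A

  false-witnesses-are-spies : ∀ {c b} xs → b ≡ not (knight c) → All (λ x → ans x c ≡ b) xs
                            → spies xs ≡ length xs
  false-witnesses-are-spies [] _ [] = refl
  false-witnesses-are-spies {c} (x ∷ xs) false-b (says ∷ rest) with knight x in kx
  ... | true  = contradiction false-b (not-¬ (trans (sym says) (honest x c kx)))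
  ... | false = cong suc (false-witnesses-are-spies xs false-b rest)

  -- A candidate rejected with a accusers and a - 1 supporters accounts for at least a
  -- spies: if he is a knight his accusers lie, if he is a spy so are his supporters.
  rejection-exposes-spies : ∀ c S A → length A ≡ suc (length S) → Supports S c → Accuses A c
                          → length A ≤ spies (c ∷ S) + spies A
  rejection-exposes-spies c S A balanced sup acc with knight c in kc
  ... | true  = subst (λ k → length A ≤ spies S + k)
                      (sym (false-witnesses-are-spies A (cong not (sym kc)) acc))
                      (m≤n+m (length A) (spies S))
  ... | false rewrite false-witnesses-are-spies S (cong not (sym kc)) sup | balanced =
                m≤m+n (suc (length S)) (spies A)

  -- If a candidate and his supporters S contain at most |S| spies, he is a knight:
  -- a spy candidate would make every supporter a false witness.
  accepted-is-knight : ∀ c S → Supports S c → spies (c ∷ S) ≤ length S → knight c ≡ true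
  accepted-is-knight c S sup bound with knight c in kc
  ... | true  = refl
  ... | false = ⊥-elim (<-irrefl refl
                  (subst (λ k → suc k ≤ length S) (false-witnesses-are-spies S (cong not (sym kc)) sup) bound))

  pool : (S A q : List (Fin n)) → List (Fin n)
  pool S A q = S ++ A ++ q

  pool-after-support : ∀ S A p q → pool (S ++ [ p ]) A q ↭ pool S A (p ∷ q)
  pool-after-support S A p q =
    ↭-trans (↭-reflexive (++-assoc S [ p ] (A ++ q))) (++⁺ˡ S (↭-sym (shift p A q)))

  pool-after-accusation : ∀ S A p q → pool S (A ++ [ p ]) q ≡ pool S A (p ∷ q)
  pool-after-accusation S A p q = cong (S ++_) (++-assoc A [ p ] q)

  record Hearing (L : ℕ) (c : Fin n) (S A q : List (Fin n)) : Set where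
    field
      supported : Supports S c
      accused   : Accuses A c
      balanced  : length A ≤ suc (length S)
      belowL    : length S ≤ L
      fewSpies  : spies (c ∷ pool S A q) ≤ L
      majority  : 2 * L ≤ length (pool S A q)

  hear-support : ∀ {L c S A p q} → Hearing L c S A (p ∷ q) → length S < L → ans p c ≡ true
               → Hearing L c (S ++ [ p ]) A q
  hear-support {L} {c} {S} {A} {p} {q} h S<L says = record
    { supported = ++⁺ supported (says ∷ [])
    ; accused   = accused
    ; balanced  = subst (λ k → length A ≤ suc k) (sym (length-snoc S p)) (m≤n⇒m≤1+n balanced)
    ; belowL    = subst (_≤ L) (sym (length-snoc S p)) S<L
    ; fewSpies  = subst (_≤ L) (sym (spies-↭ (prep c moved))) fewSpies
    ; majority  = subst (2 * L ≤_) (sym (↭-length moved)) majority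
    }
    where
    open Hearing h
    moved : pool (S ++ [ p ]) A q ↭ pool S A (p ∷ q)
    moved = pool-after-support S A p q

  hear-accusation : ∀ {L c S A p q} → Hearing L c S A (p ∷ q) → length A ≤ length S
                  → ans p c ≡ false → Hearing L c S (A ++ [ p ]) q
  hear-accusation {L} {c} {S} {A} {p} {q} h A≤S says = record
    { supported = supported
    ; accused   = ++⁺ accused (says ∷ [])
    ; balanced  = subst (_≤ suc (length S)) (sym (length-snoc A p)) (s≤s A≤S)
    ; belowL    = belowL
    ; fewSpies  = subst (λ xs → spies (c ∷ xs) ≤ L) (sym moved) fewSpies
    ; majority  = subst (λ xs → 2 * L ≤ length xs) (sym moved) majority
    }
    where
    open Hearing h
    moved : pool S (A ++ [ p ]) q ≡ pool S A (p ∷ q)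
    moved = pool-after-accusation S A p q

  Balanced : Rejected n → Set
  Balanced m = length (accusers m) ≡ suc (length (supporters m))

  accusations : List (Rejected n) → ℕ
  accusations []       = 0
  accusations (m ∷ ms) = length (accusers m) + accusations ms

  accusations-snoc : ∀ rs m → accusations (rs ++ [ m ]) ≡ accusations rs + length (accusers m)
  accusations-snoc []       m = +-identityʳ (length (accusers m))
  accusations-snoc (r ∷ rs) m =
    trans (cong (length (accusers r) +_) (accusations-snoc rs m))
          (sym (+-assoc (length (accusers r)) (accusations rs) (length (accusers m))))

  -- What Step 1 delivers, relative to the conserved quantities T = Σa + L and
  -- P = (questions asked) + (rejected candidates) + (people still in play).
  record Outcome (T P : ℕ) (res : Step1Result n) : Set where
    field
      acceptedKnight  : knight (accepted res) ≡ true
      allBalanced     : All Balanced (rejecteds res)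
      thresholdSpent  : accusations (rejecteds res) + length (kSupporters res) ≡ T
      everyoneCounted : length (questions1 res) + length (rejecteds res)
                          + suc (length (notInvolved res)) ≡ P

  Succeeds : (T P : ℕ) → Maybe (Step1Result n) → Set
  Succeeds T P run = Σ (Step1Result n) λ res → run ≡ just res × Outcome T P res

  mutual
    step1-succeeds : ∀ L queue rs qs → All Balanced rs → spies queue ≤ L → 2 * L < length queue
                   → Succeeds (accusations rs + L) (length qs + length rs + length queue)
                              (step1 ans L queue rs qs)
    step1-succeeds L (c ∷ q) rs qs bal few (s≤s majority) =
      interrogate-succeeds L c [] [] q rs qs bal record
        { supported = [] ; accused = [] ; balanced = z≤n ; belowL = z≤n
        ; fewSpies = few ; majority = majority }

    interrogate-succeeds : ∀ L c S A q rs qs → All Balanced rs → Hearing L c S A q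
                         → Succeeds (accusations rs + L) (length qs + length rs + suc (length q))
                                    (interrogate ans L c S A q rs qs)
    interrogate-succeeds L c S A q rs qs bal h with length S <ᵇ length A in rejected
    ... | true  = rejection-succeeds L c S A q rs qs bal h (<ᵇ⇒< _ _ (subst T (sym rejected) tt))
    ... | false with length S ≡ᵇ L in acceptance
    ...   | true  = step1res c S A rs q qs , refl , record
                      { acceptedKnight  = accepted-is-knight c S supported
                          (subst (spies (c ∷ S) ≤_) (sym S≡L)
                            (≤-trans (spies-prefix (c ∷ S) (A ++ q)) fewSpies))
                      ; allBalanced     = bal
                      ; thresholdSpent  = cong (accusations rs +_) S≡L
                      ; everyoneCounted = refl }
      where
      open Hearing h
      S≡L : length S ≡ L
      S≡L = ≡ᵇ⇒≡ _ _ (subst T (sym acceptance) tt)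
    ...   | false = askNext-succeeds L c S A q rs qs bal h
                      (≮⇒≥ λ S<A → subst T rejected (<⇒<ᵇ S<A))
                      (≤∧≢⇒< (Hearing.belowL h) λ S≡L → subst T acceptance (≡⇒≡ᵇ _ _ S≡L))

    rejection-succeeds : ∀ L c S A q rs qs → All Balanced rs → Hearing L c S A q → length S < length A
                       → Succeeds (accusations rs + L) (length qs + length rs + suc (length q))
                                  (step1 ans (L ∸ length A) q (rs ++ [ rej c A S ]) qs)
    rejection-succeeds L c S A q rs qs bal h S<A =
      subst₂ (λ T P → Succeeds T P (step1 ans (L ∸ a) q (rs ++ [ rej c A S ]) qs)) spent counted
        (step1-succeeds (L ∸ a) q (rs ++ [ rej c A S ]) qs (++⁺ bal (balanced′ ∷ []))
          (m+n≤o⇒m≤o∸n (spies q) (subst (_≤ L) (+-comm a (spies q)) freed))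
          (rejection-keeps-majority balanced′ a≤L
            (subst (2 * L ≤_) (trans (length-++ S) (cong (length S +_) (length-++ A))) majority)))
      where
      open Hearing h
      a : ℕ
      a = length A
      balanced′ : a ≡ suc (length S)
      balanced′ = ≤-antisym balanced S<A
      spies-split : spies (c ∷ pool S A q) ≡ spies (c ∷ S) + spies A + spies q
      spies-split = trans (spies-++ (c ∷ S) (A ++ q))
                          (trans (cong (spies (c ∷ S) +_) (spies-++ A q))
                                 (sym (+-assoc (spies (c ∷ S)) (spies A) (spies q))))
      freed : a + spies q ≤ L
      freed = ≤-trans (+-monoˡ-≤ (spies q) (rejection-exposes-spies c S A balanced′ supported accused))
                      (subst (_≤ L) spies-split fewSpies)
      a≤L : a ≤ L
      a≤L = m+n≤o⇒m≤o a freed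
      spent : accusations (rs ++ [ rej c A S ]) + (L ∸ a) ≡ accusations rs + L
      spent = begin
        accusations (rs ++ [ rej c A S ]) + (L ∸ a) ≡⟨ cong (_+ (L ∸ a)) (accusations-snoc rs (rej c A S)) ⟩
        accusations rs + a + (L ∸ a)                ≡⟨ +-assoc (accusations rs) a (L ∸ a) ⟩
        accusations rs + (a + (L ∸ a))              ≡⟨ cong (accusations rs +_) (m+[n∸m]≡n a≤L) ⟩
        accusations rs + L                          ∎
        where open ≡-Reasoning
      counted : length qs + length (rs ++ [ rej c A S ]) + length q ≡ length qs + length rs + suc (length q)
      counted = moved-into-middle (length qs) rs (rej c A S) (length q)

    askNext-succeeds : ∀ L c S A q rs qs → All Balanced rs → Hearing L c S A q
                     → length A ≤ length S → length S < L
                     → Succeeds (accusations rs + L) (length qs + length rs + suc (length q))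
                                (askNext ans L c S A q rs qs)
    askNext-succeeds L c S A [] rs qs bal h A≤S S<L =
      ⊥-elim (questions-below-majority A≤S S<L (subst (2 * L ≤_) asked-so-far (Hearing.majority h)))
      where
      asked-so-far : length (pool S A []) ≡ length S + length A
      asked-so-far = trans (length-++ S) (cong (length S +_) (trans (length-++ A) (+-identityʳ (length A))))
    askNext-succeeds L c S A (p ∷ q) rs qs bal h A≤S S<L with ans p c in says
    ... | true  = subst (λ P → Succeeds (accusations rs + L) P
                                  (interrogate ans L c (S ++ [ p ]) A q rs (qs ++ [ (p , c) ])))
                    (moved-into-first qs (p , c) (length rs) (length q))
                    (interrogate-succeeds L c (S ++ [ p ]) A q rs (qs ++ [ (p , c) ]) bal
                      (hear-support h S<L says))
    ... | false = subst (λ P → Succeeds (accusations rs + L) P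
                                  (interrogate ans L c S (A ++ [ p ]) q rs (qs ++ [ (p , c) ])))
                    (moved-into-first qs (p , c) (length rs) (length q))
                    (interrogate-succeeds L c S (A ++ [ p ]) q rs (qs ++ [ (p , c) ]) bal
                      (hear-accusation h A≤S says))

  verification : Fin n → Rejected n → List (Question n)
  verification k m = if ans k (cand m) then map (k ,_) (supporters m) else map (k ,_) (accusers m)

  verification-count : ∀ k → knight k ≡ true → ∀ m → Balanced m
                     → length (verification k m) + (if knight (cand m) then 1 else 0) ≡ length (accusers m)
  verification-count k kk m balanced rewrite honest k (cand m) kk with knight (cand m)
  ... | true  = trans (cong (_+ 1) (length-map (k ,_) (supporters m)))
                      (trans (+-comm (length (supporters m)) 1) (sym balanced))
  ... | false = trans (+-identityʳ _) (length-map (k ,_) (accusers m))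

  step3-count : ∀ k → knight k ≡ true → ∀ rs → All Balanced rs
              → length (concatMap (verification k) rs) + length (filterᵇ (knight ∘ cand) rs) ≡ accusations rs
  step3-count k kk []       []           = refl
  step3-count k kk (m ∷ rs) (bm ∷ bal) = begin
    length (verification k m ++ concatMap (verification k) rs) + length (filterᵇ (knight ∘ cand) (m ∷ rs))
      ≡⟨ cong₂ _+_ (length-++ (verification k m)) (length-filter-∷ (knight ∘ cand) m rs) ⟩
    (length (verification k m) + length (concatMap (verification k) rs))
      + ((if knight (cand m) then 1 else 0) + length (filterᵇ (knight ∘ cand) rs))
      ≡⟨ +-exchange (length (verification k m)) _ _ _ ⟩
    (length (verification k m) + (if knight (cand m) then 1 else 0))
      + (length (concatMap (verification k) rs) + length (filterᵇ (knight ∘ cand) rs))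
      ≡⟨ cong₂ _+_ (verification-count k kk m bm) (step3-count k kk rs bal) ⟩
    length (accusers m) + accusations rs ∎
    where
    open ≡-Reasoning
    +-exchange : ∀ w x y z → (w + x) + (y + z) ≡ (w + y) + (x + z)
    +-exchange = solve-∀

  later-count : ∀ res → length (laterQuestions ans res)
              ≡ length (notInvolved res) + (length (rejecteds res)
                  + (length (concatMap (verification (accepted res)) (rejecteds res)) + length (kSupporters res)))
  later-count (step1res k kS kA rs rest q1) = begin
    length (ask rest ++ named ++ witnesses ++ ask kS)
      ≡⟨ length-++ (ask rest) ⟩
    length (ask rest) + length (named ++ witnesses ++ ask kS)
      ≡⟨ cong (length (ask rest) +_) (length-++ named) ⟩
    length (ask rest) + (length named + length (witnesses ++ ask kS))
      ≡⟨ cong (λ x → length (ask rest) + (length named + x)) (length-++ witnesses) ⟩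
    length (ask rest) + (length named + (length witnesses + length (ask kS)))
      ≡⟨ cong₂ _+_ (length-map (k ,_) rest)
                   (cong₂ _+_ (length-map (λ m → (k , cand m)) rs)
                              (cong (length witnesses +_) (length-map (k ,_) kS))) ⟩
    length rest + (length rs + (length witnesses + length kS)) ∎
    where
    open ≡-Reasoning
    ask : List (Fin n) → List (Question n)
    ask = map (k ,_)
    named : List (Question n)
    named = map (λ m → (k , cand m)) rs
    witnesses : List (Question n)
    witnesses = concatMap (verification k) rs

  question-count : ∀ {ℓ N} res → Outcome ℓ N res
                 → length (questions1 res ++ laterQuestions ans res) + rejectedKnights knight res ≡ N + ℓ ∸ 1
  question-count res out =
    trans (cong (_+ rejectedKnights knight res)
                (trans (length-++ (questions1 res)) (cong (length (questions1 res) +_) (later-count res))))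
          (total-count {q1 = length (questions1 res)} {rs = length (rejecteds res)}
                       {V = length (concatMap (verification (accepted res)) (rejecteds res))}
                       {r = rejectedKnights knight res}
                       thresholdSpent everyoneCounted
                       (step3-count (accepted res) acceptedKnight (rejecteds res) allBalanced))
    where open Outcome out

proposition1 : (n ℓ : ℕ) → 1 ≤ ℓ → 2 * ℓ < n
    → (knight : Fin n → Bool) → numSpies knight ≤ ℓ
    → (ans : Fin n → Fin n → Bool)
    → (∀ i j → knight i ≡ true → ans i j ≡ knight j)
    → (order : List (Fin n)) → order ↭ allFin n
    → Σ (Step1Result n) λ res → Σ (List (Question n)) λ qs →
    spider ans ℓ order ≡ just (res , qs)
    × length qs + rejectedKnights knight res ≡ n + ℓ ∸ 1
proposition1 n ℓ _ 2ℓ<n knight fewSpies ans honest order order↭everyone =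
  res , questions1 res ++ laterQuestions ans res ,
  spider-after-step1 ans ℓ order res step1≡ ,
  trans (question-count res outcome) (cong (λ m → m + ℓ ∸ 1) everyone-once)
  where
  open Interrogation knight ans honest
  everyone-once : length order ≡ n
  everyone-once = trans (↭-length order↭everyone) (length-tabulate (λ i → i))
  spies-in-room : spies order ≤ ℓ
  spies-in-room = subst (_≤ ℓ) (sym (spies-↭ order↭everyone)) fewSpies
  run : Succeeds ℓ (length order) (step1 ans ℓ order [] [])
  run = step1-succeeds ℓ order [] [] [] spies-in-room (subst (2 * ℓ <_) (sym everyone-once) 2ℓ<n)
  res : Step1Result n
  res = proj₁ run
  step1≡ : step1 ans ℓ order [] [] ≡ just res
  step1≡ = proj₁ (proj₂ run)
  outcome : Outcome ℓ (length order) res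
  outcome = proj₂ (proj₂ run)
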